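{- Let $p$ be a prime and $k\ge 1$ an integer. If $n=p^k-1$, then $C_n\equiv -1 \pmod p$, where $C_n=\frac{1}{n+1}\binom{2n}{n}$ is the $n$th Catalan number.
   Context: $C_n=\frac{1}{n+1}\binom{2n}{n}$ denotes the $n$th Catalan number. -}

module Defs where

open import Data.Nat using (ℕ; suc; _*_; _/_)
open import Data.Nat.Combinatorics using (_C_)

-- n-th Catalan number C_n = (1/(n+1)) * binom(2n, n).
-- (n+1) always divides binom(2n,n), so natural-number division is exact.
catalan : ℕ → ℕ
catalan n = ((2 * n) C n) / suc n

module Submission where

-- Let q = p ^ k and n = q ∸ 1, so that 2n = q + (q ∸ 2).
--   * Ballot identity: (n+1)·C(2n,n+1) = n·C(2n,n).  Hence
--     catalan n = C(2n,n) ∸ C(2n,n+1), C(2n,n+1) ≤ C(2n,n) and q = n+1 divides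
--     C(2n,n); in particular p ∣ C(2n,n).
--   * Every interior binomial C(q,j), 0 < j < q, of a prime power q = p ^ k is
--     divisible by p: the absorption identity j·C(q,j) = q·C(q-1,j-1) shows that
--     otherwise p ^ k ∣ j, contradicting j < p ^ k.
--   * Shift congruence: if p divides all interior C(q,j), Pascal's rule gives
--     C(q+m,j) ≡ C(m,j) (mod p) for j < q.  By symmetry C(2n,n+1) = C(q+r,r)
--     with r = q ∸ 2, so C(2n,n+1) ≡ C(r,r) = 1 (mod p).
--   * Finally a ≡ 0 and b ≡ 1 (mod p) with b ≤ a give (a ∸ b) + 1 ≡ 0 (mod p).

open import Defs
open import Data.Nat using (ℕ; _+_; _∸_; _^_; _≥_)
open import Data.Nat.Divisibility using (_∣_)
open import Data.Nat.Primality using (Prime)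

open import Data.Nat.Base
  using (zero; suc; _*_; _<_; _≤_; _/_; _%_; NonZero; z≤n; s≤s; nonTrivial⇒nonZero; nonTrivial⇒n>1)
open import Data.Nat.Properties
open import Data.Nat.Combinatorics
  using (_C_; nCk≡nC[n∸k]; nCn≡1; nC1≡n; nCk+nC[k+1]≡[n+1]C[k+1])
open import Data.Nat.Combinatorics.Specification using (k>n⇒nCk≡0)
open import Data.Nat.Divisibility
open import Data.Nat.DivMod using (m≡m%n+[m/n]*n; m*n/n≡m; m<n⇒m%n≡m; %-distribˡ-+; m*n%n≡0)
open import Data.Nat.Primality using (prime; euclidsLemma)
open import Data.Nat.Tactic.RingSolver using (solve-∀)
open import Data.Sum using (inj₁; inj₂)
open import Relation.Nullary using (¬_; yes; no; contradiction)
open import Relation.Binary.PropositionalEquality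

open ≡-Reasoning

nC0≡1 : ∀ n → n C 0 ≡ 1
nC0≡1 n = trans (nCk≡nC[n∸k] {0} {n} z≤n) (nCn≡1 n)

-- Absorption identity k·C(n,k) = n·C(n-1,k-1), written without subtraction.
absorption : ∀ n k → suc k * (suc n C suc k) ≡ suc n * (n C k)
absorption n zero = begin
  1 * (suc n C 1)   ≡⟨ *-identityˡ _ ⟩
  suc n C 1         ≡⟨ nC1≡n (suc n) ⟩
  suc n             ≡⟨ *-identityʳ (suc n) ⟨
  suc n * 1         ≡⟨ cong (suc n *_) (nC0≡1 n) ⟨
  suc n * (n C 0)   ∎
absorption zero (suc k)
  rewrite k>n⇒nCk≡0 {1} {suc (suc k)} (s≤s (s≤s z≤n))
        | k>n⇒nCk≡0 {0} {suc k} (s≤s z≤n) = *-zeroʳ (suc (suc k))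
absorption (suc n) (suc k) = begin
  suc (suc k) * (suc N C suc (suc k))
    ≡⟨ cong (suc (suc k) *_) (nCk+nC[k+1]≡[n+1]C[k+1] N (suc k)) ⟨
  suc (suc k) * (a + b)
    ≡⟨ *-distribˡ-+ (suc (suc k)) a b ⟩
  (a + suc k * a) + suc (suc k) * b
    ≡⟨ cong₂ (λ x y → (a + x) + y) (absorption n k) (absorption n (suc k)) ⟩
  (a + N * (n C k)) + N * (n C suc k)
    ≡⟨ +-assoc a _ _ ⟩
  a + (N * (n C k) + N * (n C suc k))
    ≡⟨ cong (a +_) (*-distribˡ-+ N (n C k) (n C suc k)) ⟨
  a + N * (n C k + n C suc k)
    ≡⟨ cong (λ x → a + N * x) (nCk+nC[k+1]≡[n+1]C[k+1] n k) ⟩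
  suc N * a
    ∎
  where
  N = suc n
  a = N C suc k
  b = N C suc (suc k)

prime-power-∣-cancel : ∀ {p} → Prime p → ∀ k {j c} → ¬ (p ∣ c) → p ^ k ∣ j * c → p ^ k ∣ j
prime-power-∣-cancel _ zero {j} _ _ = 1∣ j
prime-power-∣-cancel {p} pr@(prime _) (suc k) {j} {c} p∤c pᵏ⁺¹∣jc
  with euclidsLemma j c pr (∣-trans (m∣m*n (p ^ k)) pᵏ⁺¹∣jc)
... | inj₂ p∣c = contradiction p∣c p∤c
... | inj₁ (divides j′ refl) =
  subst (p ^ suc k ∣_) (*-comm p j′) (*-monoʳ-∣ p pᵏ∣j′)
  where
  instance _ = nonTrivial⇒nonZero p
  pᵏ∣j′ : p ^ k ∣ j′
  pᵏ∣j′ = prime-power-∣-cancel pr k p∤c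
    (*-cancelˡ-∣ p (subst (p ^ suc k ∣_) (trans (cong (_* c) (*-comm j′ p)) (*-assoc p j′ c)) pᵏ⁺¹∣jc))

∣-multiple-of-binomial : ∀ q .{{_ : NonZero q}} i → q ∣ suc i * (q C suc i)
∣-multiple-of-binomial (suc n) i = subst (suc n ∣_) (sym (absorption n i)) (m∣m*n (n C i))

prime-power-∣-binomial : ∀ {p} → Prime p → ∀ k {j} → 0 < j → j < p ^ k → p ∣ p ^ k C j
prime-power-∣-binomial {p} pr@(prime _) k {suc i} _ j<pᵏ with p ∣? (p ^ k C suc i)
... | yes p∣ = p∣
... | no p∤ = contradiction (∣⇒≤ pᵏ∣j) (<⇒≱ j<pᵏ)
  where
  instance _ = nonTrivial⇒nonZero p
  instance _ = m^n≢0 p k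
  pᵏ∣j : p ^ k ∣ suc i
  pᵏ∣j = prime-power-∣-cancel pr k p∤ (∣-multiple-of-binomial (p ^ k) i)

binomial-shift : ∀ p q .{{_ : NonZero p}} → (∀ {j} → 0 < j → j < q → p ∣ q C j) →
                 ∀ m j → j < q → ((q + m) C j) % p ≡ (m C j) % p
binomial-shift p q interior m zero _ =
  cong (_% p) (trans (nC0≡1 (q + m)) (sym (nC0≡1 m)))
binomial-shift p q interior zero (suc i) i<q = begin
  ((q + 0) C suc i) % p   ≡⟨ cong (λ x → (x C suc i) % p) (+-identityʳ q) ⟩
  (q C suc i) % p         ≡⟨ n∣m⇒m%n≡0 _ p (interior (s≤s z≤n) i<q) ⟩
  0                       ≡⟨ m*n%n≡0 0 p ⟨
  0 % p                   ≡⟨ cong (_% p) (k>n⇒nCk≡0 {0} {suc i} (s≤s z≤n)) ⟨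
  (0 C suc i) % p         ∎
binomial-shift p q interior (suc m) (suc i) i<q = begin
  ((q + suc m) C suc i) % p
    ≡⟨ cong (λ x → (x C suc i) % p) (+-suc q m) ⟩
  (suc (q + m) C suc i) % p
    ≡⟨ cong (_% p) (nCk+nC[k+1]≡[n+1]C[k+1] (q + m) i) ⟨
  ((q + m) C i + (q + m) C suc i) % p
    ≡⟨ %-distribˡ-+ ((q + m) C i) _ p ⟩
  (((q + m) C i) % p + ((q + m) C suc i) % p) % p
    ≡⟨ cong₂ (λ x y → (x + y) % p) (binomial-shift p q interior m i (<-trans (n<1+n i) i<q))
                                   (binomial-shift p q interior m (suc i) i<q) ⟩
  ((m C i) % p + (m C suc i) % p) % p
    ≡⟨ %-distribˡ-+ (m C i) _ p ⟨
  (m C i + m C suc i) % p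
    ≡⟨ cong (_% p) (nCk+nC[k+1]≡[n+1]C[k+1] m i) ⟩
  (suc m C suc i) % p
    ∎

ballot : ∀ n → suc n * (2 * n C suc n) ≡ n * (2 * n C n)
ballot n = +-cancelˡ-≡ (suc n * A) _ _ (begin
  suc n * A + suc n * B    ≡⟨ *-distribˡ-+ (suc n) A B ⟨
  suc n * (A + B)          ≡⟨ cong (suc n *_) (nCk+nC[k+1]≡[n+1]C[k+1] (2 * n) n) ⟩
  suc n * (suc (2 * n) C suc n)
                           ≡⟨ absorption (2 * n) n ⟩
  suc (2 * n) * A          ≡⟨ split n A ⟩
  suc n * A + n * A        ∎)
  where
  A = 2 * n C n
  B = 2 * n C suc n
  split : ∀ n A → suc (2 * n) * A ≡ suc n * A + n * A
  split = solve-∀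

-- C(2n,n+1) ≤ C(2n,n), since (n+1)·C(2n,n+1) = n·C(2n,n) ≤ (n+1)·C(2n,n).
ballot-≤-central : ∀ n → 2 * n C suc n ≤ 2 * n C n
ballot-≤-central n = *-cancelˡ-≤ (suc n)
  (subst (_≤ suc n * (2 * n C n)) (sym (ballot n)) (*-monoˡ-≤ (2 * n C n) (n≤1+n n)))

central-factorisation : ∀ n → suc n * (2 * n C n ∸ 2 * n C suc n) ≡ 2 * n C n
central-factorisation n = begin
  suc n * (A ∸ B)        ≡⟨ *-distribˡ-∸ (suc n) A B ⟩
  suc n * A ∸ suc n * B  ≡⟨ cong (suc n * A ∸_) (ballot n) ⟩
  (A + n * A) ∸ n * A    ≡⟨ m+n∸n≡m A (n * A) ⟩
  A                      ∎
  where
  A = 2 * n C n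
  B = 2 * n C suc n

suc-∣-central : ∀ n → suc n ∣ 2 * n C n
suc-∣-central n =
  subst (suc n ∣_) (central-factorisation n) (m∣m*n (2 * n C n ∸ 2 * n C suc n))

catalan≡difference : ∀ n → catalan n ≡ 2 * n C n ∸ 2 * n C suc n
catalan≡difference n = begin
  (2 * n C n) / suc n          ≡⟨ cong (_/ suc n) (central-factorisation n) ⟨
  (suc n * D) / suc n          ≡⟨ cong (_/ suc n) (*-comm (suc n) D) ⟩
  (D * suc n) / suc n          ≡⟨ m*n/n≡m D (suc n) ⟩
  D                            ∎
  where D = 2 * n C n ∸ 2 * n C suc n

∣-difference+1 : ∀ p .{{_ : NonZero p}} {a b} → p ∣ a → b % p ≡ 1 → b ≤ a → p ∣ a ∸ b + 1
∣-difference+1 p {a} {b} p∣a b%p≡1 b≤a = subst (p ∣_) a∸t≡a∸b+1 p∣a∸t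
  where
  t = (b / p) * p
  b≡1+t : b ≡ suc t
  b≡1+t = trans (m≡m%n+[m/n]*n b p) (cong (_+ t) b%p≡1)
  1+t≤a : suc t ≤ a
  1+t≤a = subst (_≤ a) b≡1+t b≤a
  p∣a∸t : p ∣ a ∸ t
  p∣a∸t = ∣m+n∣m⇒∣n (subst (p ∣_) (sym (m+[n∸m]≡n (<⇒≤ 1+t≤a))) p∣a) (n∣m*n (b / p))
  a∸t≡a∸b+1 : a ∸ t ≡ a ∸ b + 1
  a∸t≡a∸b+1 = begin
    suc a ∸ suc t      ≡⟨ +-∸-assoc 1 1+t≤a ⟩
    1 + (a ∸ suc t)    ≡⟨ cong (λ x → 1 + (a ∸ x)) b≡1+t ⟨
    1 + (a ∸ b)        ≡⟨ +-comm 1 (a ∸ b) ⟩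
    a ∸ b + 1          ∎

ballot≡shifted : ∀ r → 2 * suc r C suc (suc r) ≡ (suc (suc r) + r) C r
ballot≡shifted r = begin
  2 * suc r C q              ≡⟨ cong (_C q) (double r) ⟩
  (q + r) C q                ≡⟨ nCk≡nC[n∸k] (m≤m+n q r) ⟩
  (q + r) C (q + r ∸ q)      ≡⟨ cong ((q + r) C_) (m+n∸m≡n q r) ⟩
  (q + r) C r                ∎
  where
  q = suc (suc r)
  double : ∀ r → 2 * suc r ≡ suc (suc r) + r
  double = solve-∀

catalan-pred≡-1 : ∀ p .{{_ : NonZero p}} → 1 < p → ∀ q → 2 ≤ q → p ∣ q →
                  (∀ {j} → 0 < j → j < q → p ∣ q C j) → p ∣ catalan (q ∸ 1) + 1
catalan-pred≡-1 p 1<p (suc (suc r)) _ p∣q interior =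
  subst (λ x → p ∣ x + 1) (sym (catalan≡difference n))
    (∣-difference+1 p (∣-trans p∣q (suc-∣-central n)) ballot%p≡1 (ballot-≤-central n))
  where
  n = suc r
  ballot%p≡1 : (2 * n C suc n) % p ≡ 1
  ballot%p≡1 = begin
    (2 * n C suc n) % p           ≡⟨ cong (_% p) (ballot≡shifted r) ⟩
    ((suc n + r) C r) % p         ≡⟨ binomial-shift p (suc n) interior r r (n≤1+n n) ⟩
    (r C r) % p                   ≡⟨ cong (_% p) (nCn≡1 r) ⟩
    1 % p                         ≡⟨ m<n⇒m%n≡m 1<p ⟩
    1                             ∎
catalan-pred≡-1 p _ (suc zero) (s≤s ()) _ _

mainTheorem2 : (p k : ℕ) → Prime p → k ≥ 1 →
    p ∣ catalan (p ^ k ∸ 1) + 1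
mainTheorem2 p (suc k) pr@(prime _) _ =
  catalan-pred≡-1 p p>1 (p ^ suc k) pᵏ⁺¹≥2 (m∣m*n (p ^ k)) (prime-power-∣-binomial pr (suc k))
  where
  instance _ = nonTrivial⇒nonZero p
  instance _ = m^n≢0 p k
  p>1 : 1 < p
  p>1 = nonTrivial⇒n>1 p
  pᵏ⁺¹≥2 : 2 ≤ p ^ suc k
  pᵏ⁺¹≥2 = ≤-trans p>1 (m≤m*n p (p ^ k))
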